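{- Let $G$ be the $2\times n$ square lattice graph with $n>2$. Then $T_1(G)=3$.
   Context: The $m\times n$ square lattice graph is the Cartesian product $P_m\,\square\,P_n$ of paths on $m$ and $n$ vertices. Graphs are finite and may have loops and multiple edges; each edge $e$ with endpoints $u,v$ has half-edges $(u,e),(v,e)$. Fix a finite alphabet $\Sigma$ and disjoint copy $\hat\Sigma=\{\hat a:a\in\Sigma\}$; elements of $\Sigma\cup\hat\Sigma$ are cohesive-end types, $\hat{\hat a}=a$. A tile is a finite multiset of cohesive-end types. A pot is a finite set $P$ of tiles such that whenever $x$ occurs in a tile of $P$, $\hat x$ occurs in some tile of $P$; $\#P$ is its number of tiles. An assembly design of a graph $G$ labels half-edges by cohesive-end types so that the two half-edges of each edge receive $a$ and $\hat a$ for some $a\in\Sigma$; $\lambda(v)$ is the multiset of labels at $v$ and $P_\lambda(G)=\{\lambda(v)\}$. $P$ realizes $G$ if $P_\lambda(G)\subseteq P$ for some assembly design $\lambda$. $T_1(G)$ is the minimum of $\#P$ over all pots $P$ that realize $G$. -}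

module Defs where

open import Data.Nat using (ℕ; zero; suc; _+_; _≤_; _<_)
open import Data.Fin using (Fin; inject₁) renaming (suc to fsuc)
open import Data.Fin.Properties using () renaming (_≟_ to _≟F_)
open import Data.Bool using (Bool; true; false; not)
open import Data.List using (List; []; _∷_; map; concatMap; allFin; length; lookup; _++_)
open import Data.Nat.ListAction using (sum)
open import Data.List.Relation.Unary.Any using (Any)
open import Data.List.Relation.Unary.All using (All)
open import Data.List.Relation.Unary.AllPairs using (AllPairs)
open import Data.Product using (Σ; _×_; _,_; proj₁; proj₂)
open import Data.Product.Properties using (≡-dec)
open import Data.Bool.Properties using () renaming (_≟_ to _≟B_)
open import Relation.Binary.Definitions using (DecidableEquality)
open import Relation.Binary.PropositionalEquality using (_≡_)
open import Relation.Nullary using (¬_; yes; no)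

-- Finite graphs (loops and multiple edges allowed).
-- Edges are given as a list of endpoint pairs; edge e has half-edges
-- (proj₁ e , e) and (proj₂ e , e).

record Graph : Set₁ where
  field
    V      : Set
    _≟V_   : DecidableEquality V
    edges  : List (V × V)

  Edge : Set
  Edge = Fin (length edges)

  ends : Edge → V × V
  ends e = lookup edges e

pathEdges : (n : ℕ) → List (Fin n × Fin n)
pathEdges zero    = []
pathEdges (suc n) = map (λ j → inject₁ j , fsuc j) (allFin n)

lattice : ℕ → ℕ → Graph
lattice m n = record
  { V     = Fin m × Fin n
  ; _≟V_  = ≡-dec _≟F_ _≟F_
  ; edges =
      concatMap (λ uv → map (λ j → (proj₁ uv , j) , (proj₂ uv , j)) (allFin n)) (pathEdges m)
      ++ concatMap (λ i → map (λ uv → (i , proj₁ uv) , (i , proj₂ uv)) (pathEdges n)) (allFin m)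
  }

-- Cohesive-end types over the alphabet Σ = Fin k:
-- (a , false) is a, (a , true) is â.

CE : ℕ → Set
CE k = Fin k × Bool

hat : ∀ {k} → CE k → CE k
hat (a , b) = a , not b

_≟CE_ : ∀ {k} → DecidableEquality (CE k)
_≟CE_ = ≡-dec _≟F_ _≟B_

-- A tile is a finite multiset of cohesive-end types, given by multiplicities.
Tile : ℕ → Set
Tile k = CE k → ℕ

_≈T_ : ∀ {k} → Tile k → Tile k → Set
T ≈T T' = ∀ t → T t ≡ T' t

-- A pot: a finite set (duplicate-free list) of tiles closed under hat
-- in the sense: whenever x occurs in a tile of P, x̂ occurs in some tile of P.
record IsPot {k : ℕ} (P : List (Tile k)) : Set where
  field
    distinct : AllPairs (λ T T' → ¬ (T ≈T T')) P
    closed   : All (λ T → ∀ t → 0 < T t → Any (λ T' → 0 < T' (hat t)) P) P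

#_ : ∀ {k} → List (Tile k) → ℕ
# P = length P

-- A design assigns to each edge e a pair (a , b):
-- the half-edge at the first endpoint gets (a , b) and the half-edge at
-- the second endpoint gets hat (a , b) = (a , not b). Every labelling in which
-- the two half-edges get a and â (for some a ∈ Σ) is of this form.

Design : ℕ → Graph → Set
Design k G = Graph.Edge G → CE k

private
  ind : Bool → ℕ
  ind true  = 1
  ind false = 0

  eqb : ∀ {A : Set} → DecidableEquality A → A → A → Bool
  eqb d x y with d x y
  ... | yes _ = true
  ... | no  _ = false

tileAt : ∀ {k} (G : Graph) → Design k G → Graph.V G → Tile k
tileAt {k} G λ' v t = sum (map contrib (allFin (length (Graph.edges G))))
  where
    open Graph G
    contrib : Edge → ℕ
    contrib e =
      ind (eqb _≟V_ (proj₁ (ends e)) v Data.Bool.∧ eqb _≟CE_ (λ' e) t)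
      + ind (eqb _≟V_ (proj₂ (ends e)) v Data.Bool.∧ eqb _≟CE_ (hat (λ' e)) t)

Realizes : ∀ {k} → Graph → List (Tile k) → Set
Realizes {k} G P = Σ (Design k G) λ λ' → ∀ v → Any (λ T → T ≈T tileAt G λ' v) P

-- T₁(G) = t : some pot with t tiles realizes G, and every realizing pot has ≥ t tiles.
-- The alphabet Σ = Fin k is allowed to be any finite alphabet.
T₁≡ : Graph → ℕ → Set
T₁≡ G t =
  Σ ℕ (λ k → Σ (List (Tile k)) λ P → IsPot P × Realizes G P × # P ≡ t)
  × (∀ k (P : List (Tile k)) → IsPot P → Realizes G P → t ≤ # P)

{-# OPTIONS --safe #-}

-- Three tiles suffice: over the one-letter alphabet {a}, label every edge of the top row a at its
-- left end, every edge of the bottom row â at its left end, and every rung a at its top end except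
-- the first one, which gets â there. The corners then carry {a, â}, the inner top vertices
-- {a, a, â} and the inner bottom vertices {â, â, a}.
--
-- Two tiles do not. Call a tile balanced when it contains every type t as often as t̂. Since the
-- two half-edges of an edge carry some t and t̂, over all vertices each t occurs as often as t̂ (the
-- handshake lemma). The corners have two half-edges and (0, 1) has three (this uses n ≥ 3), so with
-- at most two tiles every vertex carries either the tile C of (0, 0) or the tile M of (0, 1). The
-- two ends of the first rung then share C, which forces C = {x, x̂}, a balanced tile. A
-- three-element multiset is never balanced, so some t occurs in M more often than t̂, and hence,
-- summed over all vertices, more often than t̂.

module Submission where

open import Defs
open import Data.Nat using (ℕ; _<_)

open import Data.Bool using (true; false; if_then_else_)
open import Data.Bool.Properties using (not-involutive; not-¬)
open import Data.Empty using (⊥; ⊥-elim)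
open import Data.Fin using (Fin; fromℕ; inject₁) renaming (zero to fzero; suc to fsuc)
open import Data.Fin.Properties using (inject₁-injective; fromℕ≢inject₁)
  renaming (suc-injective to fsuc-injective; _≟_ to _≟F_)
open import Data.Fin.Relation.Unary.Top using (view; ‵fromℕ; ‵inject₁)
open import Data.List using (List; []; _∷_; _++_; map; tabulate; allFin; cartesianProduct; length)
open import Data.List.Properties
  using (∷-injective; ++-identityʳ; map-++; map-∘; map-cong; map-tabulate; tabulate-cong; tabulate-lookup)
open import Data.List.Membership.Propositional using (_∈_)
open import Data.List.Membership.Propositional.Properties using (∈-cartesianProduct⁺; ∈-allFin)
open import Data.List.Relation.Unary.All using ([]; _∷_)
open import Data.List.Relation.Unary.AllPairs using ([]; _∷_)
open import Data.List.Relation.Unary.Any as Any using (Any; here; there)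
open import Data.Nat using (zero; suc; _+_; _*_; _≤_; z≤n; s≤s)
open import Data.Nat.ListAction using (sum)
open import Data.Nat.ListAction.Properties using (sum-++)
open import Data.Nat.Properties
open import Algebra.Properties.CommutativeSemigroup +-commutativeSemigroup using (interchange)
open import Data.Nat.Tactic.RingSolver using (solve-∀)
open import Data.Product using (Σ; ∃; ∃₂; _×_; _,_; proj₁; proj₂; uncurry)
open import Data.Product.Properties using (≡-dec; ,-injective)
open import Data.Sum using (_⊎_; inj₁; inj₂; [_,_]′)
open import Function using (_∘_; id)
open import Function.Definitions using (Injective)
open import Relation.Binary.Definitions using (DecidableEquality)
open import Relation.Binary.PropositionalEquality
open import Relation.Nullary using (Dec; yes; no; does; ¬_; _×-dec_; contradiction)
open import Relation.Nullary.Decidable using (dec-true; dec-false)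

private
  variable
    A B : Set
    k m n : ℕ

χ : Dec A → ℕ
χ a? = if does a? then 1 else 0

χ-yes : (a? : Dec A) → A → χ a? ≡ 1
χ-yes a? a rewrite dec-true a? a = refl

χ-no : (a? : Dec A) → ¬ A → χ a? ≡ 0
χ-no a? ¬a rewrite dec-false a? ¬a = refl

χ-cong : (A → B) → (B → A) → (a? : Dec A) (b? : Dec B) → χ a? ≡ χ b?
χ-cong f g (yes a) b? = sym (χ-yes b? (f a))
χ-cong f g (no ¬a) b? = sym (χ-no b? (¬a ∘ g))

χ-× : (a? : Dec A) (b? : Dec B) → χ (a? ×-dec b?) ≡ χ a? * χ b?
χ-× (yes _) (yes _) = refl
χ-× (yes _) (no _)  = refl
χ-× (no _)  _       = refl

χ-≡-dec : (_≟A_ : DecidableEquality A) (_≟B_ : DecidableEquality B) (a a′ : A) (b b′ : B) →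
          χ (≡-dec _≟A_ _≟B_ (a , b) (a′ , b′)) ≡ χ (a ≟A a′) * χ (b ≟B b′)
χ-≡-dec _≟A_ _≟B_ a a′ b b′ =
  trans (χ-cong ,-injective (uncurry (cong₂ _,_))
                (≡-dec _≟A_ _≟B_ (a , b) (a′ , b′)) (a ≟A a′ ×-dec b ≟B b′))
        (χ-× (a ≟A a′) (b ≟B b′))

χ-sym : (_≟_ : DecidableEquality A) (x y : A) → χ (x ≟ y) ≡ χ (y ≟ x)
χ-sym _≟_ x y = χ-cong sym sym (x ≟ y) (y ≟ x)

sum-map-+ : (f g : A → ℕ) (xs : List A) → sum (map (λ x → f x + g x) xs) ≡ sum (map f xs) + sum (map g xs)
sum-map-+ f g []       = refl
sum-map-+ f g (x ∷ xs) = trans (cong (f x + g x +_) (sum-map-+ f g xs)) (interchange (f x) (g x) _ _)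

sum-map-*ʳ : (f : A → ℕ) (c : ℕ) (xs : List A) → sum (map (λ x → f x * c) xs) ≡ sum (map f xs) * c
sum-map-*ʳ f c []       = refl
sum-map-*ʳ f c (x ∷ xs) = trans (cong (f x * c +_) (sum-map-*ʳ f c xs)) (sym (*-distribʳ-+ c (f x) _))

sum-map-comm : (f : A → B → ℕ) (xs : List A) (ys : List B) →
               sum (map (λ x → sum (map (f x) ys)) xs) ≡ sum (map (λ y → sum (map (λ x → f x y) xs)) ys)
sum-map-comm f []       ys = sym (sum-map-zero ys)
  where
  sum-map-zero : (ys : List B) → sum (map (λ _ → 0) ys) ≡ 0
  sum-map-zero []       = refl
  sum-map-zero (_ ∷ ys) = sum-map-zero ys
sum-map-comm f (x ∷ xs) ys = trans (cong (sum (map (f x) ys) +_) (sum-map-comm f xs ys))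
                                   (sym (sum-map-+ (f x) (λ y → sum (map (λ x′ → f x′ y) xs)) ys))

sum-cartesianProduct : (f : A × B → ℕ) (xs : List A) (ys : List B) →
  sum (map f (cartesianProduct xs ys)) ≡ sum (map (λ x → sum (map (λ y → f (x , y)) ys)) xs)
sum-cartesianProduct f []       ys = refl
sum-cartesianProduct f (x ∷ xs) ys = begin
  sum (map f (map (x ,_) ys ++ cartesianProduct xs ys))
    ≡⟨ cong sum (map-++ f (map (x ,_) ys) _) ⟩
  sum (map f (map (x ,_) ys) ++ map f (cartesianProduct xs ys))
    ≡⟨ sum-++ (map f (map (x ,_) ys)) _ ⟩
  sum (map f (map (x ,_) ys)) + sum (map f (cartesianProduct xs ys))
    ≡⟨ cong₂ _+_ (cong sum (sym (map-∘ ys))) (sum-cartesianProduct f xs ys) ⟩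
  sum (map (λ y → f (x , y)) ys) + sum (map (λ x → sum (map (λ y → f (x , y)) ys)) xs)
    ∎
  where open ≡-Reasoning

sum-map-mono-≤ : {f g : A → ℕ} → (∀ x → f x ≤ g x) → (xs : List A) → sum (map f xs) ≤ sum (map g xs)
sum-map-mono-≤ f≤g []       = z≤n
sum-map-mono-≤ f≤g (x ∷ xs) = +-mono-≤ (f≤g x) (sum-map-mono-≤ f≤g xs)

sum-map-mono-< : {f g : A → ℕ} → (∀ x → f x ≤ g x) → {x : A} {xs : List A} →
                 x ∈ xs → f x < g x → sum (map f xs) < sum (map g xs)
sum-map-mono-< f≤g {xs = _ ∷ xs} (here refl) fx<gx = +-mono-<-≤ fx<gx (sum-map-mono-≤ f≤g xs)
sum-map-mono-< f≤g {xs = y ∷ _} (there x∈xs) fx<gx = +-mono-≤-< (f≤g y) (sum-map-mono-< f≤g x∈xs fx<gx)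

sum-tabulate-zero : (h : Fin n → ℕ) → (∀ j → h j ≡ 0) → sum (tabulate h) ≡ 0
sum-tabulate-zero {zero}  h h≡0 = refl
sum-tabulate-zero {suc n} h h≡0 = cong₂ _+_ (h≡0 fzero) (sum-tabulate-zero (h ∘ fsuc) (h≡0 ∘ fsuc))

sum-tabulate-point : (h : Fin n → ℕ) (j₀ : Fin n) → (∀ j → j ≢ j₀ → h j ≡ 0) → sum (tabulate h) ≡ h j₀
sum-tabulate-point h fzero h≡0 =
  trans (cong (h fzero +_) (sum-tabulate-zero (h ∘ fsuc) (λ j → h≡0 (fsuc j) (λ ())))) (+-identityʳ _)
sum-tabulate-point h (fsuc j₀) h≡0 =
  cong₂ _+_ (h≡0 fzero (λ ()))
            (sum-tabulate-point (h ∘ fsuc) j₀ (λ j j≢j₀ → h≡0 (fsuc j) (j≢j₀ ∘ fsuc-injective)))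

sum-map-*ˡ : (c : ℕ) (f : A → ℕ) (xs : List A) → sum (map (λ x → c * f x) xs) ≡ c * sum (map f xs)
sum-map-*ˡ c f []       = sym (*-zeroʳ c)
sum-map-*ˡ c f (x ∷ xs) = trans (cong (c * f x +_) (sum-map-*ˡ c f xs)) (sym (*-distribˡ-+ c (f x) _))

sum-tabulate-+ : (f g : Fin n → ℕ) → sum (tabulate (λ j → f j + g j)) ≡ sum (tabulate f) + sum (tabulate g)
sum-tabulate-+ f g = begin
  sum (tabulate (λ j → f j + g j))                 ≡⟨ cong sum (map-tabulate id (λ j → f j + g j)) ⟨
  sum (map (λ j → f j + g j) (allFin _))           ≡⟨ sum-map-+ f g (allFin _) ⟩
  sum (map f (allFin _)) + sum (map g (allFin _))  ≡⟨ cong₂ _+_ (cong sum (map-tabulate id f))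
                                                                (cong sum (map-tabulate id g)) ⟩
  sum (tabulate f) + sum (tabulate g)              ∎
  where open ≡-Reasoning

module _ {A : Set} (_≟_ : DecidableEquality A) where

  sum-tabulate-select : (σ : Fin m → A) → Injective _≡_ _≡_ σ → (f : Fin m → ℕ) (j₀ : Fin m) →
                        sum (tabulate (λ j → χ (σ j ≟ σ j₀) * f j)) ≡ f j₀
  sum-tabulate-select σ σ-inj f j₀ =
    trans (sum-tabulate-point _ j₀ (λ j j≢j₀ → cong (_* f j) (χ-no (σ j ≟ σ j₀) (j≢j₀ ∘ σ-inj))))
          (trans (cong (_* f j₀) (χ-yes (σ j₀ ≟ σ j₀) refl)) (*-identityˡ (f j₀)))

  sum-tabulate-miss : (σ : Fin m → A) {u : A} → (∀ j → σ j ≢ u) → (f : Fin m → ℕ) →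
                      sum (tabulate (λ j → χ (σ j ≟ u) * f j)) ≡ 0
  sum-tabulate-miss σ {u} σ≢u f = sum-tabulate-zero _ (λ j → cong (_* f j) (χ-no (σ j ≟ u) (σ≢u j)))

Enumerates : {V : Set} → DecidableEquality V → List V → Set
Enumerates _≟_ vs = ∀ u → sum (map (λ v → χ (u ≟ v)) vs) ≡ 1

allFin-enumerates : Enumerates _≟F_ (allFin n)
allFin-enumerates u = begin
  sum (map (λ j → χ (u ≟F j)) (allFin _))  ≡⟨ cong sum (map-tabulate id (λ j → χ (u ≟F j))) ⟩
  sum (tabulate (λ j → χ (u ≟F j)))        ≡⟨ cong sum (tabulate-cong (λ j →
                                                trans (χ-sym _≟F_ u j) (sym (*-identityʳ _)))) ⟩
  sum (tabulate (λ j → χ (j ≟F u) * 1))    ≡⟨ sum-tabulate-select _≟F_ id id (λ _ → 1) u ⟩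
  1                                        ∎
  where open ≡-Reasoning

cartesianProduct-enumerates : {_≟A_ : DecidableEquality A} {_≟B_ : DecidableEquality B} {xs : List A} {ys : List B} →
  Enumerates _≟A_ xs → Enumerates _≟B_ ys → Enumerates (≡-dec _≟A_ _≟B_) (cartesianProduct xs ys)
cartesianProduct-enumerates {_≟A_ = _≟A_} {_≟B_} {xs} {ys} enum-xs enum-ys (a , b) = begin
  sum (map (λ v → χ (≡-dec _≟A_ _≟B_ (a , b) v)) (cartesianProduct xs ys))
    ≡⟨ sum-cartesianProduct _ xs ys ⟩
  sum (map (λ x → sum (map (λ y → χ (≡-dec _≟A_ _≟B_ (a , b) (x , y))) ys)) xs)
    ≡⟨ cong sum (map-cong (λ x → cong sum (map-cong (χ-≡-dec _≟A_ _≟B_ a x b) ys)) xs) ⟩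
  sum (map (λ x → sum (map (λ y → χ (a ≟A x) * χ (b ≟B y)) ys)) xs)
    ≡⟨ cong sum (map-cong (λ x → trans (sum-map-*ˡ (χ (a ≟A x)) (λ y → χ (b ≟B y)) ys)
                                       (trans (cong (χ (a ≟A x) *_) (enum-ys b)) (*-identityʳ _))) xs) ⟩
  sum (map (λ x → χ (a ≟A x)) xs)
    ≡⟨ enum-xs a ⟩
  1 ∎
  where open ≡-Reasoning

map-≡-++⁻ : (f : A → B) (L : List A) (xs ys : List B) → map f L ≡ xs ++ ys →
            ∃₂ λ L₁ L₂ → L ≡ L₁ ++ L₂ × map f L₁ ≡ xs × map f L₂ ≡ ys
map-≡-++⁻ f L       []       ys eq = [] , L , refl , refl , eq
map-≡-++⁻ f (z ∷ L) (x ∷ xs) ys eq with ∷-injective eq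
... | fz≡x , eq′ with map-≡-++⁻ f L xs ys eq′
... | L₁ , L₂ , L≡ , eq₁ , eq₂ = z ∷ L₁ , L₂ , cong (z ∷_) L≡ , cong₂ _∷_ fz≡x eq₁ , eq₂

map-proj₁-≡-tabulate⁻ : {C : Set} (L : List (A × C)) (g : Fin n → A) → map proj₁ L ≡ tabulate g →
                        Σ (Fin n → C) λ c → L ≡ tabulate (λ j → g j , c j)
map-proj₁-≡-tabulate⁻ {n = zero}  []      g eq = (λ ()) , refl
map-proj₁-≡-tabulate⁻ {n = suc n} {C = C} (z ∷ L) g eq with ∷-injective eq
... | z₁≡g0 , eq′ with map-proj₁-≡-tabulate⁻ L (g ∘ fsuc) eq′
... | c , L≡ = c′ , cong₂ _∷_ (cong (_, proj₂ z) z₁≡g0) L≡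
  where
  c′ : Fin (suc n) → C
  c′ fzero    = proj₂ z
  c′ (fsuc j) = c j

-- Tiles as multisets of cohesive-end types

δ : CE k → Tile k
δ a t = χ (a ≟CE t)

infixr 30 _⊕_
_⊕_ : Tile k → Tile k → Tile k
(X ⊕ Y) t = X t + Y t

Balanced : Tile k → Set
Balanced T = ∀ t → T (hat t) ≡ T t

module _ {k : ℕ} where

  hat-involutive : (x : CE k) → hat (hat x) ≡ x
  hat-involutive (a , b) = cong (a ,_) (not-involutive b)

  hat-≢ : (x : CE k) → x ≢ hat x
  hat-≢ (a , b) x≡x̂ = not-¬ refl (cong proj₂ x≡x̂)

  δ-self : (a : CE k) → δ a a ≡ 1
  δ-self a = χ-yes (a ≟CE a) refl

  δ-≢ : {a t : CE k} → a ≢ t → δ a t ≡ 0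
  δ-≢ {a} {t} = χ-no (a ≟CE t)

  δ-pos : (a t : CE k) → 0 < δ a t → a ≡ t
  δ-pos a t with a ≟CE t
  ... | yes a≡t = λ _ → a≡t
  ... | no _    = λ ()

  δ-hat : (a t : CE k) → δ a (hat t) ≡ δ (hat a) t
  δ-hat a t = χ-cong (λ a≡t̂ → trans (cong hat a≡t̂) (hat-involutive t))
                     (λ â≡t → trans (sym (hat-involutive a)) (cong hat â≡t)) (a ≟CE hat t) (hat a ≟CE t)

  δ-hat-hat : (a t : CE k) → δ (hat a) (hat t) ≡ δ a t
  δ-hat-hat a t = trans (δ-hat (hat a) t) (cong (λ x → δ x t) (hat-involutive a))

  δ-injective : {a b : CE k} → δ a ≈T δ b → a ≡ b
  δ-injective {a} {b} δa≈δb = sym (δ-pos b a (subst (0 <_) (δa≈δb a) (≤-reflexive (sym (δ-self a)))))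

  δ-⊕-self : (a : CE k) (X : Tile k) → 0 < (δ a ⊕ X) a
  δ-⊕-self a X rewrite δ-self a = s≤s z≤n

  ⊕-pos : (X Y : Tile k) (t : CE k) → 0 < (X ⊕ Y) t → 0 < X t ⊎ 0 < Y t
  ⊕-pos X Y t pos with X t
  ... | zero  = inj₂ pos
  ... | suc _ = inj₁ (s≤s z≤n)

  ⊕-cancelˡ : (Z X Y : Tile k) → Z ⊕ X ≈T Z ⊕ Y → X ≈T Y
  ⊕-cancelˡ Z X Y eq t = +-cancelˡ-≡ (Z t) (X t) (Y t) (eq t)

  ⊕-comm : (X Y : Tile k) → X ⊕ Y ≈T Y ⊕ X
  ⊕-comm X Y t = +-comm (X t) (Y t)

  pair-∋ : (a b t : CE k) → 0 < (δ a ⊕ δ b) t → a ≡ t ⊎ b ≡ t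
  pair-∋ a b t pos with ⊕-pos (δ a) (δ b) t pos
  ... | inj₁ pos-a = inj₁ (δ-pos a t pos-a)
  ... | inj₂ pos-b = inj₂ (δ-pos b t pos-b)

  single≉pair : (a b c : CE k) → ¬ (δ a ≈T δ b ⊕ δ c)
  single≉pair a b c eq with δ-pos a b (subst (0 <_) (sym (eq b)) (δ-⊕-self b (δ c)))
  ... | refl = 1+n≢n (sym (trans (eq c) (trans (cong (δ a c +_) (δ-self c)) (+-comm (δ a c) 1))))

  pair≉triple : (a b c d e : CE k) → ¬ (δ a ⊕ δ b ≈T δ c ⊕ δ d ⊕ δ e)
  pair≉triple a b c d e eq with pair-∋ a b c (subst (0 <_) (sym (eq c)) (δ-⊕-self c (δ d ⊕ δ e)))
  ... | inj₁ refl = single≉pair b d e (⊕-cancelˡ (δ a) (δ b) (δ d ⊕ δ e) eq)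
  ... | inj₂ refl = single≉pair a d e (⊕-cancelˡ (δ b) (δ a) (δ d ⊕ δ e) (λ t → trans (⊕-comm (δ b) (δ a) t) (eq t)))

  pair-hat-balanced : (a : CE k) → Balanced (δ a ⊕ δ (hat a))
  pair-hat-balanced a t = trans (cong₂ _+_ (δ-hat a t) (δ-hat-hat a t)) (+-comm (δ (hat a) t) (δ a t))

  pair≈pair-hat⇒hat : (a b c : CE k) → δ a ⊕ δ b ≈T δ (hat a) ⊕ δ c → b ≡ hat a
  pair≈pair-hat⇒hat a b c eq with pair-∋ (hat a) c a (subst (0 <_) (eq a) (δ-⊕-self a (δ b)))
  ... | inj₁ â≡a = contradiction (sym â≡a) (hat-≢ a)
  ... | inj₂ refl =
    δ-injective (⊕-cancelˡ (δ a) (δ b) (δ (hat a)) (λ t → trans (eq t) (⊕-comm (δ (hat a)) (δ a) t)))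

  complementary-triple-unbalanced : (a c : CE k) → (δ a ⊕ δ (hat a) ⊕ δ c) (hat c) < (δ a ⊕ δ (hat a) ⊕ δ c) c
  complementary-triple-unbalanced a c = begin-strict
    δ a (hat c) + (δ (hat a) (hat c) + δ c (hat c)) ≡⟨ cong₂ _+_ (δ-hat a c)
                                                                  (cong₂ _+_ (δ-hat-hat a c) (δ-≢ (hat-≢ c))) ⟩
    δ (hat a) c + (δ a c + 0)                        <⟨ ≤-reflexive (shuffle (δ a c) (δ (hat a) c)) ⟩
    δ a c + (δ (hat a) c + 1)                        ≡⟨ cong (λ n → δ a c + (δ (hat a) c + n)) (δ-self c) ⟨
    δ a c + (δ (hat a) c + δ c c)                    ∎
    where
    open ≤-Reasoning
    shuffle : ∀ x y → suc (y + (x + 0)) ≡ x + (y + 1)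
    shuffle = solve-∀

  triple-unbalanced : (a b c : CE k) → ∃ λ t → (δ a ⊕ δ b ⊕ δ c) (hat t) < (δ a ⊕ δ b ⊕ δ c) t
  triple-unbalanced a b c with b ≟CE hat a | c ≟CE hat a
  ... | yes refl | _       = c , complementary-triple-unbalanced a c
  ... | no _     | yes refl = b , subst₂ _<_ (swap (hat b)) (swap b) (complementary-triple-unbalanced a b)
    where
    swap : ∀ t → (δ a ⊕ δ (hat a) ⊕ δ b) t ≡ (δ a ⊕ δ b ⊕ δ (hat a)) t
    swap t = cong (δ a t +_) (+-comm (δ (hat a) t) (δ b t))
  ... | no b≢â   | no c≢â  = a , subst (_< (δ a ⊕ δ b ⊕ δ c) a) absent (δ-⊕-self a (δ b ⊕ δ c))
    where
    absent : 0 ≡ (δ a ⊕ δ b ⊕ δ c) (hat a)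
    absent = sym (cong₂ _+_ (δ-≢ (hat-≢ a)) (cong₂ _+_ (δ-≢ b≢â) (δ-≢ c≢â)))

module _ {k : ℕ} where

  _∈ᵀ_ : Tile k → List (Tile k) → Set
  X ∈ᵀ P = Any (_≈T X) P

  ∈ᵀ-resp : {X Y : Tile k} {P : List (Tile k)} → X ≈T Y → X ∈ᵀ P → Y ∈ᵀ P
  ∈ᵀ-resp X≈Y = Any.map (λ T≈X t → trans (T≈X t) (X≈Y t))

  ∈ᵀ-singleton : {A X Z : Tile k} → X ∈ᵀ (A ∷ []) → Z ∈ᵀ (A ∷ []) → Z ≈T X
  ∈ᵀ-singleton (here A≈X) (here A≈Z) t = trans (sym (A≈Z t)) (A≈X t)

  ∈ᵀ-pair : {A B X Y Z : Tile k} → ¬ X ≈T Y →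
            X ∈ᵀ (A ∷ B ∷ []) → Y ∈ᵀ (A ∷ B ∷ []) → Z ∈ᵀ (A ∷ B ∷ []) → Z ≈T X ⊎ Z ≈T Y
  ∈ᵀ-pair X≉Y (here A≈X)  Y∈        (here A≈Z)  = inj₁ (∈ᵀ-singleton (here A≈X) (here A≈Z))
  ∈ᵀ-pair X≉Y (there X∈)  (here A≈Y) (here A≈Z)  = inj₂ (∈ᵀ-singleton (here A≈Y) (here A≈Z))
  ∈ᵀ-pair X≉Y (there X∈)  (there Y∈) (here _)    = contradiction (λ t → sym (∈ᵀ-singleton X∈ Y∈ t)) X≉Y
  ∈ᵀ-pair X≉Y (there X∈)  Y∈        (there Z∈)  = inj₁ (∈ᵀ-singleton X∈ Z∈)
  ∈ᵀ-pair X≉Y (here _)    (there Y∈) (there Z∈)  = inj₂ (∈ᵀ-singleton Y∈ Z∈)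
  ∈ᵀ-pair X≉Y (here A≈X)  (here A≈Y) (there _)   = contradiction (λ t → trans (sym (A≈X t)) (A≈Y t)) X≉Y

  ∈ᵀ-length<3 : {P : List (Tile k)} {X Y Z : Tile k} → length P < 3 → ¬ X ≈T Y →
                X ∈ᵀ P → Y ∈ᵀ P → Z ∈ᵀ P → Z ≈T X ⊎ Z ≈T Y
  ∈ᵀ-length<3 {_ ∷ []}         _ X≉Y X∈ _  Z∈ = inj₁ (∈ᵀ-singleton X∈ Z∈)
  ∈ᵀ-length<3 {_ ∷ _ ∷ []}     _ X≉Y X∈ Y∈ Z∈ = ∈ᵀ-pair X≉Y X∈ Y∈ Z∈
  ∈ᵀ-length<3 {_ ∷ _ ∷ _ ∷ _} (s≤s (s≤s (s≤s ()))) _ _ _ _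

-- Tiles of a list of labelled edges, and the handshake lemma

module _ {V : Set} (_≟_ : DecidableEquality V) {k : ℕ} where

  labelCount : V → CE k → (V × V) × CE k → ℕ
  labelCount v t ((a , b) , l) = χ (a ≟ v) * δ l t + χ (b ≟ v) * δ (hat l) t

  tileOf : List ((V × V) × CE k) → V → Tile k
  tileOf L v t = sum (map (labelCount v t) L)

  tileOf-++ : (L L′ : List ((V × V) × CE k)) (v : V) → tileOf (L ++ L′) v ≈T tileOf L v ⊕ tileOf L′ v
  tileOf-++ L L′ v t = trans (cong sum (map-++ (labelCount v t) L L′)) (sum-++ (map (labelCount v t) L) _)

  tileOf-tabulate : (e : Fin n → V × V) (l : Fin n → CE k) (v : V) (t : CE k) →
                    tileOf (tabulate (λ j → e j , l j)) v t ≡ sum (tabulate (λ j → labelCount v t (e j , l j)))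
  tileOf-tabulate e l v t = cong sum (map-tabulate (λ j → e j , l j) (labelCount v t))

  module _ {vs : List V} (enum : Enumerates _≟_ vs) where

    labelCount-total : (t : CE k) (e : (V × V) × CE k) →
                       sum (map (λ v → labelCount v t e) vs) ≡ (δ (proj₂ e) ⊕ δ (hat (proj₂ e))) t
    labelCount-total t ((a , b) , l) = begin
      sum (map (λ v → χ (a ≟ v) * δ l t + χ (b ≟ v) * δ (hat l) t) vs)
        ≡⟨ sum-map-+ (λ v → χ (a ≟ v) * δ l t) (λ v → χ (b ≟ v) * δ (hat l) t) vs ⟩
      sum (map (λ v → χ (a ≟ v) * δ l t) vs) + sum (map (λ v → χ (b ≟ v) * δ (hat l) t) vs)
        ≡⟨ cong₂ _+_ (sum-map-*ʳ (λ v → χ (a ≟ v)) (δ l t) vs)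
                     (sum-map-*ʳ (λ v → χ (b ≟ v)) (δ (hat l) t) vs) ⟩
      sum (map (λ v → χ (a ≟ v)) vs) * δ l t + sum (map (λ v → χ (b ≟ v)) vs) * δ (hat l) t
        ≡⟨ cong₂ _+_ (trans (cong (_* δ l t) (enum a)) (*-identityˡ _))
                     (trans (cong (_* δ (hat l) t) (enum b)) (*-identityˡ _)) ⟩
      δ l t + δ (hat l) t
        ∎
      where open ≡-Reasoning

    tileOf-total : (L : List ((V × V) × CE k)) (t : CE k) →
                   sum (map (λ v → tileOf L v t) vs) ≡ sum (map (λ e → (δ (proj₂ e) ⊕ δ (hat (proj₂ e))) t) L)
    tileOf-total L t = trans (sum-map-comm (λ v → labelCount v t) vs L) (cong sum (map-cong (labelCount-total t) L))

    handshake : (L : List ((V × V) × CE k)) (t : CE k) →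
                sum (map (λ v → tileOf L v (hat t)) vs) ≡ sum (map (λ v → tileOf L v t) vs)
    handshake L t = begin
      sum (map (λ v → tileOf L v (hat t)) vs)                        ≡⟨ tileOf-total L (hat t) ⟩
      sum (map (λ e → (δ (proj₂ e) ⊕ δ (hat (proj₂ e))) (hat t)) L)  ≡⟨ cong sum (map-cong (λ e →
                                                                          pair-hat-balanced (proj₂ e) t) L) ⟩
      sum (map (λ e → (δ (proj₂ e) ⊕ δ (hat (proj₂ e))) t) L)        ≡⟨ tileOf-total L t ⟨
      sum (map (λ v → tileOf L v t) vs)                              ∎
      where open ≡-Reasoning

    balanced⊎skewed⇒⊥ : (L : List ((V × V) × CE k)) (C M : Tile k) (t : CE k) → Balanced C → M (hat t) < M t →
                        (∀ v → tileOf L v ≈T C ⊎ tileOf L v ≈T M) →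
                        {v₀ : V} → v₀ ∈ vs → tileOf L v₀ ≈T M → ⊥
    balanced⊎skewed⇒⊥ L C M t C-balanced M-skewed C⊎M v₀∈vs v₀≈M =
      <-irrefl (handshake L t) (sum-map-mono-< hat-t≤t v₀∈vs (skewed v₀≈M))
      where
      skewed : ∀ {v} → tileOf L v ≈T M → tileOf L v (hat t) < tileOf L v t
      skewed v≈M = subst₂ _<_ (sym (v≈M (hat t))) (sym (v≈M t)) M-skewed
      hat-t≤t : ∀ v → tileOf L v (hat t) ≤ tileOf L v t
      hat-t≤t v with C⊎M v
      ... | inj₁ v≈C = ≤-reflexive (trans (v≈C (hat t)) (trans (C-balanced t) (sym (v≈C t))))
      ... | inj₂ v≈M = <⇒≤ (skewed v≈M)

module _ (G : Graph) {k : ℕ} where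
  open Graph G

  labelledEdges : Design k G → List ((V × V) × CE k)
  labelledEdges λ′ = tabulate (λ e → ends e , λ′ e)

  map-proj₁-labelledEdges : (λ′ : Design k G) → map proj₁ (labelledEdges λ′) ≡ edges
  map-proj₁-labelledEdges λ′ = trans (map-tabulate _ proj₁) (tabulate-lookup edges)

  labelledEdges-ends : (F : V × V → CE k) → labelledEdges (F ∘ ends) ≡ map (λ x → x , F x) edges
  labelledEdges-ends F = trans (sym (map-tabulate ends (λ x → x , F x)))
                               (cong (map (λ x → x , F x)) (tabulate-lookup edges))

  -- The indicators inside tileAt are private to Defs; a one-edge graph exposes the contribution of one edge.
  private
    singleEdge : V × V → Graph
    singleEdge p = record { V = V ; _≟V_ = _≟V_ ; edges = p ∷ [] }

    singleEdge-tile : ∀ p (l : CE k) v t → tileAt (singleEdge p) (λ _ → l) v t ≡ labelCount _≟V_ v t (p , l) + 0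
    singleEdge-tile (a , b) l v t with a ≟V v | b ≟V v | l ≟CE t | hat l ≟CE t
    ... | yes _ | yes _ | yes _ | yes _ = refl
    ... | yes _ | yes _ | yes _ | no _  = refl
    ... | yes _ | yes _ | no _  | yes _ = refl
    ... | yes _ | yes _ | no _  | no _  = refl
    ... | yes _ | no _  | yes _ | yes _ = refl
    ... | yes _ | no _  | yes _ | no _  = refl
    ... | yes _ | no _  | no _  | yes _ = refl
    ... | yes _ | no _  | no _  | no _  = refl
    ... | no _  | yes _ | yes _ | yes _ = refl
    ... | no _  | yes _ | yes _ | no _  = refl
    ... | no _  | yes _ | no _  | yes _ = refl
    ... | no _  | yes _ | no _  | no _  = refl
    ... | no _  | no _  | yes _ | yes _ = refl
    ... | no _  | no _  | yes _ | no _  = refl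
    ... | no _  | no _  | no _  | yes _ = refl
    ... | no _  | no _  | no _  | no _  = refl

  tileAt≈tileOf : (λ′ : Design k G) (v : V) → tileAt G λ′ v ≈T tileOf _≟V_ (labelledEdges λ′) v
  tileAt≈tileOf λ′ v t = begin
    tileAt G λ′ v t
      ≡⟨ cong sum (map-cong (λ e → sym (+-identityʳ _)) (allFin (length edges))) ⟩
    sum (map (λ e → tileAt (singleEdge (ends e)) (λ _ → λ′ e) v t) (allFin (length edges)))
      ≡⟨ cong sum (map-cong (λ e → trans (singleEdge-tile (ends e) (λ′ e) v t) (+-identityʳ _))
                            (allFin (length edges))) ⟩
    sum (map (λ e → labelCount _≟V_ v t (ends e , λ′ e)) (allFin (length edges)))
      ≡⟨ cong sum (map-tabulate id (λ e → labelCount _≟V_ v t (ends e , λ′ e))) ⟩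
    sum (tabulate (λ e → labelCount _≟V_ v t (ends e , λ′ e)))
      ≡⟨ cong sum (map-tabulate (λ e → ends e , λ′ e) (labelCount _≟V_ v t)) ⟨
    tileOf _≟V_ (labelledEdges λ′) v t
      ∎
    where open ≡-Reasoning

-- The ladder P₂ □ Pₙ

i₀ i₁ : Fin 2
i₀ = fzero
i₁ = fsuc fzero

LadderEdge : ℕ → Set
LadderEdge n = (Fin 2 × Fin n) × (Fin 2 × Fin n)

_≟L_ : DecidableEquality (Fin 2 × Fin n)
_≟L_ = ≡-dec _≟F_ _≟F_

rung : Fin n → LadderEdge n
rung j = (i₀ , j) , (i₁ , j)

rowEdge : Fin 2 → Fin m → LadderEdge (suc m)
rowEdge i j = (i , inject₁ j) , (i , fsuc j)

lattice-2-edges : (m : ℕ) →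
                  Graph.edges (lattice 2 (suc m)) ≡ tabulate rung ++ tabulate (rowEdge i₀) ++ tabulate (rowEdge i₁)
lattice-2-edges m = cong₂ _++_ (trans (++-identityʳ _) (map-tabulate id rung))
                              (cong₂ _++_ (row i₀) (trans (++-identityʳ _) (row i₁)))
  where
  row : (i : Fin 2) → map (λ uv → (i , proj₁ uv) , (i , proj₂ uv)) (pathEdges (suc m)) ≡ tabulate (rowEdge i)
  row i = trans (sym (map-∘ (allFin m))) (map-tabulate id (rowEdge i))

ladderVertices : (n : ℕ) → List (Fin 2 × Fin n)
ladderVertices n = cartesianProduct (allFin 2) (allFin n)

ladderVertices-enumerates : Enumerates _≟L_ (ladderVertices n)
ladderVertices-enumerates {n} =
  cartesianProduct-enumerates {_≟A_ = _≟F_} {_≟F_} {allFin 2} {allFin n} allFin-enumerates allFin-enumerates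

module _ {k : ℕ} where

  labelledRungs : (Fin n → CE k) → List (LadderEdge n × CE k)
  labelledRungs r = tabulate (λ j → rung j , r j)

  labelledRow : Fin 2 → (Fin m → CE k) → List (LadderEdge (suc m) × CE k)
  labelledRow i p = tabulate (λ j → rowEdge i j , p j)

  ladder : (Fin (suc m) → CE k) → (Fin m → CE k) → (Fin m → CE k) → List (LadderEdge (suc m) × CE k)
  ladder r p q = labelledRungs r ++ labelledRow i₀ p ++ labelledRow i₁ q

  labelledEdges-ladder : (λ′ : Design k (lattice 2 (suc m))) →
    ∃ λ r → ∃₂ λ p q → labelledEdges (lattice 2 (suc m)) λ′ ≡ ladder r p q
  labelledEdges-ladder {m} λ′
    with map-≡-++⁻ proj₁ _ _ _ (trans (map-proj₁-labelledEdges (lattice 2 (suc m)) λ′) (lattice-2-edges m))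
  ... | L₁ , L₂₃ , L≡ , eq₁ , eq₂₃ with map-≡-++⁻ proj₁ L₂₃ _ _ eq₂₃
  ... | L₂ , L₃ , L₂₃≡ , eq₂ , eq₃ with map-proj₁-≡-tabulate⁻ L₁ rung eq₁
                                      | map-proj₁-≡-tabulate⁻ L₂ (rowEdge i₀) eq₂
                                      | map-proj₁-≡-tabulate⁻ L₃ (rowEdge i₁) eq₃
  ... | r , L₁≡ | p , L₂≡ | q , L₃≡ = r , p , q , trans L≡ (cong₂ _++_ L₁≡ (trans L₂₃≡ (cong₂ _++_ L₂≡ L₃≡)))

  pathTile : (Fin m → CE k) → Fin (suc m) → Tile k
  pathTile p = tileOf _≟F_ (tabulate (λ j → (inject₁ j , fsuc j) , p j))

  pathTile-split : (p : Fin m → CE k) (j₀ : Fin (suc m)) (t : CE k) →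
    pathTile p j₀ t ≡ sum (tabulate (λ j → χ (inject₁ j ≟F j₀) * δ (p j) t))
                      + sum (tabulate (λ j → χ (fsuc j ≟F j₀) * δ (hat (p j)) t))
  pathTile-split p j₀ t =
    trans (cong sum (map-tabulate (λ j → (inject₁ j , fsuc j) , p j) (labelCount _≟F_ j₀ t)))
          (sum-tabulate-+ (λ j → χ (inject₁ j ≟F j₀) * δ (p j) t) (λ j → χ (fsuc j ≟F j₀) * δ (hat (p j)) t))

  pathTile-first : (p : Fin (suc m) → CE k) → pathTile p fzero ≈T δ (p fzero)
  pathTile-first p t = trans (pathTile-split p fzero t)
    (trans (cong₂ _+_ (sum-tabulate-select _≟F_ inject₁ inject₁-injective (λ j → δ (p j) t) fzero)
                      (sum-tabulate-miss _≟F_ fsuc {fzero} (λ j ()) (λ j → δ (hat (p j)) t)))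
           (+-identityʳ _))

  pathTile-inner : (p : Fin (suc m) → CE k) (j : Fin m) →
                   pathTile p (fsuc (inject₁ j)) ≈T δ (p (fsuc j)) ⊕ δ (hat (p (inject₁ j)))
  pathTile-inner p j t = trans (pathTile-split p (fsuc (inject₁ j)) t)
    (cong₂ _+_ (sum-tabulate-select _≟F_ inject₁ inject₁-injective (λ j → δ (p j) t) (fsuc j))
               (sum-tabulate-select _≟F_ fsuc fsuc-injective (λ j → δ (hat (p j)) t) (inject₁ j)))

  pathTile-last : (p : Fin (suc m) → CE k) → pathTile p (fsuc (fromℕ m)) ≈T δ (hat (p (fromℕ m)))
  pathTile-last {m} p t = trans (pathTile-split p (fsuc (fromℕ m)) t)
    (cong₂ _+_ (sum-tabulate-miss _≟F_ inject₁ (λ j → fromℕ≢inject₁ ∘ sym) (λ j → δ (p j) t))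
               (sum-tabulate-select _≟F_ fsuc fsuc-injective (λ j → δ (hat (p j)) t) (fromℕ m)))

  tileOf-ladder : (r : Fin (suc m) → CE k) (p q : Fin m → CE k) (v : Fin 2 × Fin (suc m)) →
                  tileOf _≟L_ (ladder r p q) v ≈T tileOf _≟L_ (labelledRungs r) v ⊕ tileOf _≟L_ (labelledRow i₀ p) v
                                                  ⊕ tileOf _≟L_ (labelledRow i₁ q) v
  tileOf-ladder r p q v t = trans (tileOf-++ _≟L_ (labelledRungs r) _ v t)
                                  (cong (_ +_) (tileOf-++ _≟L_ (labelledRow i₀ p) _ v t))

  ladder-top : (r : Fin (suc m) → CE k) (p q : Fin m → CE k) (j₀ : Fin (suc m)) →
               tileOf _≟L_ (ladder r p q) (i₀ , j₀) ≈T δ (r j₀) ⊕ pathTile p j₀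
  ladder-top r p q j₀ t = begin
    tileOf _≟L_ (ladder r p q) (i₀ , j₀) t                ≡⟨ tileOf-ladder r p q (i₀ , j₀) t ⟩
    (tileOf _≟L_ (labelledRungs r) (i₀ , j₀) ⊕ tileOf _≟L_ (labelledRow i₀ p) (i₀ , j₀)
                                         ⊕ tileOf _≟L_ (labelledRow i₁ q) (i₀ , j₀)) t
                                                          ≡⟨ cong₂ _+_ rungs (cong₂ _+_ own-row other-row) ⟩
    δ (r j₀) t + (pathTile p j₀ t + 0)                    ≡⟨ cong (δ (r j₀) t +_) (+-identityʳ _) ⟩
    δ (r j₀) t + pathTile p j₀ t                          ∎
    where
    open ≡-Reasoning
    rungs : tileOf _≟L_ (labelledRungs r) (i₀ , j₀) t ≡ δ (r j₀) t
    rungs = trans (tileOf-tabulate _≟L_ rung r (i₀ , j₀) t)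
                  (trans (cong sum (tabulate-cong (λ j → +-identityʳ (χ (j ≟F j₀) * δ (r j) t))))
                         (sum-tabulate-select _≟F_ id id (λ j → δ (r j) t) j₀))
    own-row : tileOf _≟L_ (labelledRow i₀ p) (i₀ , j₀) t ≡ pathTile p j₀ t
    own-row = trans (tileOf-tabulate _≟L_ (rowEdge i₀) p (i₀ , j₀) t)
                    (sym (tileOf-tabulate _≟F_ (λ j → inject₁ j , fsuc j) p j₀ t))
    other-row : tileOf _≟L_ (labelledRow i₁ q) (i₀ , j₀) t ≡ 0
    other-row = trans (tileOf-tabulate _≟L_ (rowEdge i₁) q (i₀ , j₀) t)
                      (sum-tabulate-zero (λ j → labelCount _≟L_ (i₀ , j₀) t (rowEdge i₁ j , q j)) (λ _ → refl))

  ladder-bottom : (r : Fin (suc m) → CE k) (p q : Fin m → CE k) (j₀ : Fin (suc m)) →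
                  tileOf _≟L_ (ladder r p q) (i₁ , j₀) ≈T δ (hat (r j₀)) ⊕ pathTile q j₀
  ladder-bottom r p q j₀ t = begin
    tileOf _≟L_ (ladder r p q) (i₁ , j₀) t                ≡⟨ tileOf-ladder r p q (i₁ , j₀) t ⟩
    (tileOf _≟L_ (labelledRungs r) (i₁ , j₀) ⊕ tileOf _≟L_ (labelledRow i₀ p) (i₁ , j₀)
                                         ⊕ tileOf _≟L_ (labelledRow i₁ q) (i₁ , j₀)) t
                                                          ≡⟨ cong₂ _+_ rungs (cong₂ _+_ other-row own-row) ⟩
    δ (hat (r j₀)) t + (0 + pathTile q j₀ t)              ∎
    where
    open ≡-Reasoning
    rungs : tileOf _≟L_ (labelledRungs r) (i₁ , j₀) t ≡ δ (hat (r j₀)) t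
    rungs = trans (tileOf-tabulate _≟L_ rung r (i₁ , j₀) t)
                  (sum-tabulate-select _≟F_ id id (λ j → δ (hat (r j)) t) j₀)
    own-row : tileOf _≟L_ (labelledRow i₁ q) (i₁ , j₀) t ≡ pathTile q j₀ t
    own-row = trans (tileOf-tabulate _≟L_ (rowEdge i₁) q (i₁ , j₀) t)
                    (sym (tileOf-tabulate _≟F_ (λ j → inject₁ j , fsuc j) q j₀ t))
    other-row : tileOf _≟L_ (labelledRow i₀ p) (i₁ , j₀) t ≡ 0
    other-row = trans (tileOf-tabulate _≟L_ (rowEdge i₀) p (i₁ , j₀) t)
                      (sum-tabulate-zero (λ j → labelCount _≟L_ (i₁ , j₀) t (rowEdge i₀ j , p j)) (λ _ → refl))

-- Two tiles do not suffice

module _ {k m : ℕ} (r : Fin (3 + m) → CE k) (p q : Fin (2 + m) → CE k) where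

  ladder-tiles⇒3≤ : (P : List (Tile k)) → (∀ v → tileOf _≟L_ (ladder r p q) v ∈ᵀ P) → 3 ≤ # P
  ladder-tiles⇒3≤ P tiles∈P = ≮⇒≥ λ #P<3 →
    balanced⊎skewed⇒⊥ _≟L_ ladderVertices-enumerates (ladder r p q) C M t (C-balanced #P<3) M-skewed (C⊎M #P<3)
                      (∈-cartesianProduct⁺ (∈-allFin i₀) (∈-allFin (fsuc fzero))) tile₀₁
    where
    C C′ M : Tile k
    C  = δ (r fzero) ⊕ δ (p fzero)
    C′ = δ (hat (r fzero)) ⊕ δ (q fzero)
    M  = δ (r (fsuc fzero)) ⊕ δ (p (fsuc fzero)) ⊕ δ (hat (p fzero))

    tile₀₀ : tileOf _≟L_ (ladder r p q) (i₀ , fzero) ≈T C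
    tile₀₀ t = trans (ladder-top r p q fzero t) (cong (δ (r fzero) t +_) (pathTile-first p t))
    tile₁₀ : tileOf _≟L_ (ladder r p q) (i₁ , fzero) ≈T C′
    tile₁₀ t = trans (ladder-bottom r p q fzero t) (cong (δ (hat (r fzero)) t +_) (pathTile-first q t))
    tile₀₁ : tileOf _≟L_ (ladder r p q) (i₀ , fsuc fzero) ≈T M
    tile₀₁ t = trans (ladder-top r p q (fsuc fzero) t) (cong (δ (r (fsuc fzero)) t +_) (pathTile-inner p fzero t))

    C∈P : C ∈ᵀ P
    C∈P = ∈ᵀ-resp tile₀₀ (tiles∈P (i₀ , fzero))
    M∈P : M ∈ᵀ P
    M∈P = ∈ᵀ-resp tile₀₁ (tiles∈P (i₀ , fsuc fzero))
    C≉M : ¬ C ≈T M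
    C≉M = pair≉triple (r fzero) (p fzero) (r (fsuc fzero)) (p (fsuc fzero)) (hat (p fzero))
    C′≉M : ¬ C′ ≈T M
    C′≉M = pair≉triple (hat (r fzero)) (q fzero) (r (fsuc fzero)) (p (fsuc fzero)) (hat (p fzero))

    C⊎M : # P < 3 → ∀ v → tileOf _≟L_ (ladder r p q) v ≈T C ⊎ tileOf _≟L_ (ladder r p q) v ≈T M
    C⊎M #P<3 v = ∈ᵀ-length<3 #P<3 C≉M C∈P M∈P (tiles∈P v)

    C′≈C⇒C-balanced : C′ ≈T C → Balanced C
    C′≈C⇒C-balanced C′≈C = subst (λ x → Balanced (δ (r fzero) ⊕ δ x))
                                 (sym (pair≈pair-hat⇒hat (r fzero) (p fzero) (q fzero) (λ t → sym (C′≈C t))))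
                                 (pair-hat-balanced (r fzero))

    C-balanced : # P < 3 → Balanced C
    C-balanced #P<3 = [ C′≈C⇒C-balanced , ⊥-elim ∘ C′≉M ]′
                        (∈ᵀ-length<3 #P<3 C≉M C∈P M∈P (∈ᵀ-resp tile₁₀ (tiles∈P (i₁ , fzero))))

    t : CE k
    t = proj₁ (triple-unbalanced (r (fsuc fzero)) (p (fsuc fzero)) (hat (p fzero)))
    M-skewed : M (hat t) < M t
    M-skewed = proj₂ (triple-unbalanced (r (fsuc fzero)) (p (fsuc fzero)) (hat (p fzero)))

realizes-ladder⇒3≤ : {k : ℕ} (m : ℕ) (P : List (Tile k)) → Realizes (lattice 2 (3 + m)) P → 3 ≤ # P
realizes-ladder⇒3≤ m P (λ′ , realized) =
  let r , p , q , λ′≡ladder = labelledEdges-ladder λ′ in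
  ladder-tiles⇒3≤ r p q P λ v → ∈ᵀ-resp (λ t → trans (tileAt≈tileOf (lattice 2 (3 + m)) λ′ v t)
                                                      (cong (λ L → tileOf _≟L_ L v t) λ′≡ladder))
                                         (realized v)

-- Three tiles suffice

a : CE 1
a = fzero , false

tile₁-ext : {X Y : Tile 1} → X a ≡ Y a → X (hat a) ≡ Y (hat a) → X ≈T Y
tile₁-ext eq-a eq-â (fzero , false) = eq-a
tile₁-ext eq-a eq-â (fzero , true)  = eq-â

upperLabel : LadderEdge n → CE 1
upperLabel ((fzero  , _)      , (fzero  , _)) = a
upperLabel ((fzero  , fzero)  , (fsuc _ , _)) = hat a
upperLabel ((fzero  , fsuc _) , (fsuc _ , _)) = a
upperLabel ((fsuc _ , _)      , _)            = hat a

upperPot : List (Tile 1)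
upperPot = δ a ⊕ δ (hat a) ∷ δ a ⊕ δ a ⊕ δ (hat a) ∷ δ (hat a) ⊕ δ (hat a) ⊕ δ a ∷ []

upperPot-isPot : IsPot upperPot
upperPot-isPot = record
  { distinct = (differ-at a (λ ()) ∷ differ-at (hat a) (λ ()) ∷ []) ∷ (differ-at a (λ ()) ∷ []) ∷ [] ∷ []
  ; closed   = complement-present ∷ complement-present ∷ complement-present ∷ []
  }
  where
  differ-at : {X Y : Tile 1} (t : CE 1) → X t ≢ Y t → ¬ X ≈T Y
  differ-at t Xt≢Yt X≈Y = Xt≢Yt (X≈Y t)
  complement-present : {T : Tile 1} (t : CE 1) → 0 < T t → Any (λ T′ → 0 < T′ (hat t)) upperPot
  complement-present (fzero , false) _ = here (s≤s z≤n)
  complement-present (fzero , true)  _ = here (s≤s z≤n)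

module _ (m : ℕ) where

  rᵁ : Fin (3 + m) → CE 1
  rᵁ = upperLabel ∘ rung
  pᵁ qᵁ : Fin (2 + m) → CE 1
  pᵁ = upperLabel ∘ rowEdge i₀
  qᵁ = upperLabel ∘ rowEdge i₁

  labelledEdges-upper : labelledEdges (lattice 2 (3 + m)) (upperLabel ∘ Graph.ends (lattice 2 (3 + m)))
                        ≡ ladder rᵁ pᵁ qᵁ
  labelledEdges-upper = begin
    labelledEdges (lattice 2 (3 + m)) (upperLabel ∘ Graph.ends (lattice 2 (3 + m)))
      ≡⟨ labelledEdges-ends (lattice 2 (3 + m)) upperLabel ⟩
    map labelled (Graph.edges (lattice 2 (3 + m)))
      ≡⟨ cong (map labelled) (lattice-2-edges (2 + m)) ⟩
    map labelled (tabulate rung ++ tabulate (rowEdge i₀) ++ tabulate (rowEdge i₁))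
      ≡⟨ trans (map-++ labelled (tabulate rung) _)
               (cong (map labelled (tabulate rung) ++_) (map-++ labelled (tabulate (rowEdge i₀)) _)) ⟩
    map labelled (tabulate rung) ++ map labelled (tabulate (rowEdge i₀)) ++ map labelled (tabulate (rowEdge i₁))
      ≡⟨ cong₂ _++_ (map-tabulate rung labelled)
                    (cong₂ _++_ (map-tabulate (rowEdge i₀) labelled) (map-tabulate (rowEdge i₁) labelled)) ⟩
    ladder rᵁ pᵁ qᵁ
      ∎
    where
    open ≡-Reasoning
    labelled : LadderEdge (3 + m) → LadderEdge (3 + m) × CE 1
    labelled x = x , upperLabel x

  via-top : (j : Fin (3 + m)) {Y : Tile 1} → pathTile pᵁ j ≈T Y → δ (rᵁ j) ⊕ Y ∈ᵀ upperPot →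
            tileOf _≟L_ (ladder rᵁ pᵁ qᵁ) (i₀ , j) ∈ᵀ upperPot
  via-top j path≈Y =
    ∈ᵀ-resp (λ t → sym (trans (ladder-top rᵁ pᵁ qᵁ j t) (cong (δ (rᵁ j) t +_) (path≈Y t))))

  via-bottom : (j : Fin (3 + m)) {Y : Tile 1} → pathTile qᵁ j ≈T Y → δ (hat (rᵁ j)) ⊕ Y ∈ᵀ upperPot →
               tileOf _≟L_ (ladder rᵁ pᵁ qᵁ) (i₁ , j) ∈ᵀ upperPot
  via-bottom j path≈Y =
    ∈ᵀ-resp (λ t → sym (trans (ladder-bottom rᵁ pᵁ qᵁ j t) (cong (δ (hat (rᵁ j)) t +_) (path≈Y t))))

  upperLadder-tiles : ∀ v → tileOf _≟L_ (ladder rᵁ pᵁ qᵁ) v ∈ᵀ upperPot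
  upperLadder-tiles (fzero      , fzero) = via-top    fzero (pathTile-first pᵁ) (here (tile₁-ext refl refl))
  upperLadder-tiles (fsuc fzero , fzero) = via-bottom fzero (pathTile-first qᵁ) (here (tile₁-ext refl refl))
  upperLadder-tiles (i , fsuc j) with view j
  upperLadder-tiles (fzero      , fsuc ._) | ‵fromℕ =
    via-top    (fsuc (fromℕ (suc m))) (pathTile-last pᵁ) (here (tile₁-ext refl refl))
  upperLadder-tiles (fsuc fzero , fsuc ._) | ‵fromℕ =
    via-bottom (fsuc (fromℕ (suc m))) (pathTile-last qᵁ) (here (tile₁-ext refl refl))
  upperLadder-tiles (fzero      , fsuc ._) | ‵inject₁ j′ =
    via-top    (fsuc (inject₁ j′)) (pathTile-inner pᵁ j′) (there (here (tile₁-ext refl refl)))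
  upperLadder-tiles (fsuc fzero , fsuc ._) | ‵inject₁ j′ =
    via-bottom (fsuc (inject₁ j′)) (pathTile-inner qᵁ j′) (there (there (here (tile₁-ext refl refl))))

  upperPot-realizes : Realizes (lattice 2 (3 + m)) upperPot
  upperPot-realizes = upperLabel ∘ Graph.ends (lattice 2 (3 + m)) , λ v →
    ∈ᵀ-resp (λ t → sym (trans (tileAt≈tileOf (lattice 2 (3 + m)) _ v t)
                              (cong (λ L → tileOf _≟L_ L v t) labelledEdges-upper)))
            (upperLadder-tiles v)

proposition7 : (n : ℕ) → 2 < n → T₁≡ (lattice 2 n) 3
proposition7 (suc (suc (suc m))) (s≤s (s≤s (s≤s _))) =
  (1 , upperPot , upperPot-isPot , upperPot-realizes m , refl) , λ k P _ → realizes-ladder⇒3≤ m P
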